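{- Let $R=\{(a,b): a,b\in\{1,2,3\}\}$. Then $(123,R)\sim_d(132,R)$.
   Context: $S_n$ denotes the set of permutations of $[n]=\{1,\dots,n\}$, written $\pi=\pi_1\cdots\pi_n$. A mesh pattern of length $k$ is a pair $(\tau,R)$ with $\tau\in S_k$ and $R\subseteq\{0,1,\dots,k\}^2$ (the shaded boxes; box $(a,b)$ is the unit square $[a,a+1]\times[b,b+1]$ in the diagram of $\tau$). An occurrence of $(\tau,R)$ in $\pi\in S_n$ is a choice of indices $i_1<\dots<i_k$ such that $\pi_{i_1}\cdots\pi_{i_k}$ is order-isomorphic to $\tau$ and, with $i_0=0$, $i_{k+1}=n+1$, $v_1<\dots<v_k$ the values $\pi_{i_1},\dots,\pi_{i_k}$ sorted increasingly, $v_0=0$, $v_{k+1}=n+1$, for every $(a,b)\in R$ there is no index $m$ with $i_a<m<i_{a+1}$ and $v_b<\pi_m<v_{b+1}$. Mesh patterns $p,q$ are equidistributed, $p\sim_d q$, if for all $n,\ell\ge0$ the number of $\pi\in S_n$ with exactly $\ell$ occurrences of $p$ equals the number with exactly $\ell$ occurrences of $q$. -}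

module Defs where

open import Data.Nat using (ℕ; zero; suc; _+_; _∸_; _<ᵇ_; _≡ᵇ_)
open import Data.Bool using (Bool; true; false; _∧_; _∨_; not; if_then_else_)
open import Data.List using (List; []; _∷_; map; length; filterᵇ; concatMap; upTo)
open import Data.Bool.ListAction using (all; any)
open import Data.Product using (_×_; _,_)

-- Conventions: permutations, patterns, indices and values are all 1-based
-- natural numbers stored in lists, exactly as in the paper.

range : ℕ → List ℕ
range n = map suc (upTo n)

words : ℕ → ℕ → List (List ℕ)
words n zero    = [] ∷ []
words n (suc k) = concatMap (λ x → map (x ∷_) (words n k)) (range n)

elem : ℕ → List ℕ → Bool
elem x ys = any (λ y → x ≡ᵇ y) ys

distinct : List ℕ → Bool
distinct []       = true
distinct (x ∷ xs) = not (elem x xs) ∧ distinct xs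

Sn : ℕ → List (List ℕ)
Sn n = filterᵇ distinct (words n n)

-- i-th entry (1-based) of a list, 0 if out of range
at : List ℕ → ℕ → ℕ
at []       _             = 0
at (x ∷ xs) zero          = 0
at (x ∷ xs) (suc zero)    = x
at (x ∷ xs) (suc (suc i)) = at xs (suc i)

increasing : List ℕ → Bool
increasing []           = true
increasing (x ∷ [])     = true
increasing (x ∷ y ∷ xs) = (x <ᵇ y) ∧ increasing (y ∷ xs)

insert : ℕ → List ℕ → List ℕ
insert x []       = x ∷ []
insert x (y ∷ ys) = if x <ᵇ y then x ∷ y ∷ ys else y ∷ insert x ys

sortℕ : List ℕ → List ℕ
sortℕ []       = []
sortℕ (x ∷ xs) = insert x (sortℕ xs)

record MeshPattern : Set where
  constructor mesh
  field
    len    : ℕ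
    τ      : List ℕ
    shaded : List (ℕ × ℕ)
open MeshPattern public

orderIso : ℕ → List ℕ → List ℕ → Bool
orderIso k xs ys =
  all (λ a → all (λ b → (at xs a <ᵇ at xs b) ≡ᵇ' (at ys a <ᵇ at ys b)) (range k)) (range k)
  where
  _≡ᵇ'_ : Bool → Bool → Bool
  true  ≡ᵇ' b = b
  false ≡ᵇ' b = not b

isOccurrence : MeshPattern → (n : ℕ) → List ℕ → List ℕ → Bool
isOccurrence p n π is =
  increasing is ∧ orderIso k vals (τ p) ∧ all boxOK (shaded p)
  where
  k    = len p
  vals = map (at π) is
  svs  = sortℕ vals
  i : ℕ → ℕ
  i zero    = 0
  i (suc a) = if suc a ≡ᵇ suc k then suc n else at is (suc a)
  v : ℕ → ℕ
  v zero    = 0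
  v (suc b) = if suc b ≡ᵇ suc k then suc n else at svs (suc b)
  boxOK : ℕ × ℕ → Bool
  boxOK (a , b) =
    not (any (λ m → (i a <ᵇ m) ∧ (m <ᵇ i (suc a))
                   ∧ (v b <ᵇ at π m) ∧ (at π m <ᵇ v (suc b))) (range n))

occ : MeshPattern → (n : ℕ) → List ℕ → ℕ
occ p n π = length (filterᵇ (isOccurrence p n π) (words n (len p)))

countWith : MeshPattern → ℕ → ℕ → ℕ
countWith p n ℓ = length (filterᵇ (λ π → occ p n π ≡ᵇ ℓ) (Sn n))

_∼d_ : MeshPattern → MeshPattern → Set
p ∼d q = (n ℓ : ℕ) → countWith p n ℓ ≡ countWith q n ℓ
  where open import Relation.Binary.PropositionalEquality using (_≡_)

R123 : List (ℕ × ℕ)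
R123 = concatMap (λ a → map (λ b → (a , b)) (range 3)) (range 3)

p123 : MeshPattern
p123 = mesh 3 (1 ∷ 2 ∷ 3 ∷ []) R123

p132 : MeshPattern
p132 = mesh 3 (1 ∷ 3 ∷ 2 ∷ []) R123

-- An occurrence of (1ab, R) with R = {1,2,3}² is an entry followed by exactly two larger
-- entries, which form the pattern ab. Build a permutation of a k-set from its first entry x,
-- which has some number j of larger entries after it, and a permutation of the remaining set.
-- Whether the two largest entries of the result form an ascent is decided by j alone when
-- j ≤ 1 (a descent for j = 0, an ascent for j = 1) and is inherited from the rest when j ≥ 2;
-- and x is an occurrence iff j = 2 and the inherited top pair has the shape ab. Hence the
-- joint distribution of (number of occurrences, top pair ascending) satisfies the same
-- recursion for 123 and for 132 up to exchanging ascent and descent, i.e. the roles of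
-- j = 0 and j = 1; summing over the second component gives the theorem.

{-# OPTIONS --safe #-}
module Submission where

open import Defs
open import Data.Bool using (Bool; true; false; _∧_; _∨_; not; if_then_else_; T; T?)
open import Data.Bool.Properties using (T-≡; T-∧; ∧-zeroʳ; ∧-identityʳ; ∧-comm; ∧-assoc)
open import Data.Bool.ListAction using (all; any)
open import Data.Empty using (⊥; ⊥-elim)
open import Data.List
  using (List; []; _∷_; _++_; map; length; filterᵇ; concatMap; upTo; applyUpTo; applyDownFrom; drop; cartesianProductWith)
open import Data.List.Properties
  using ( length-++; length-map; length-upTo; length-filter; ∷-injective; map-∘; map-cong; map-cong-local
        ; map-upTo; map-applyUpTo; concatMap-cong; filter-++; filter-none; filter-all; filter-accept; filter-reject)
open import Data.List.Membership.Propositional using (_∈_; find; lose)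
open import Data.List.Membership.Propositional.Properties
  using ( ∈-map⁻; ∈-upTo⁻; ∈-filter⁺; ∈-filter⁻; ∈-cartesianProduct⁺; ∈-cartesianProduct⁻
        ; ∈-cartesianProductWith⁺; ∈-cartesianProductWith⁻)
open import Data.List.Relation.Binary.Permutation.Propositional
  using (_↭_; ↭-refl; ↭-prep; ↭-swap; ↭-sym; ↭-trans; ↭-reflexive; ↭⇒↭ₛ; module PermutationReasoning)
open import Data.List.Relation.Binary.Permutation.Propositional.Properties using (↭-length; ∈-resp-↭; filter-↭)
import Data.List.Relation.Binary.Permutation.Setoid.Properties as Permutationₛ
open import Data.List.Relation.Unary.All as All using (All; []; _∷_)
import Data.List.Relation.Unary.All.Properties as Allₚ
open import Data.List.Relation.Unary.AllPairs as AllPairs using (AllPairs; []; _∷_)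
import Data.List.Relation.Unary.AllPairs.Properties as AllPairsₚ
open import Data.List.Relation.Unary.Any using (here; there)
open import Data.List.Relation.Unary.Any.Properties using (any⁺; any⁻)
open import Data.List.Relation.Unary.Unique.Propositional using (Unique)
import Data.List.Relation.Unary.Unique.Propositional.Properties as Uniqueₚ
open import Data.Nat using (ℕ; zero; suc; _+_; _<_; _≤_; _<ᵇ_; _≡ᵇ_; _≟_; s≤s; s<s)
open import Data.Nat.ListAction using (sum)
open import Data.Nat.Properties
  using ( <ᵇ⇒<; <⇒<ᵇ; ≡ᵇ⇒≡; ≡⇒≡ᵇ; <-cmp; <-irrefl; <-asym; <-trans; ≤-<-trans; <⇒≤; ≮⇒≥; <⇒≢; >⇒≢
        ; suc-injective; +-identityʳ; +-assoc; +-comm; +-suc; module ≤-Reasoning)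
open import Data.Product using (_×_; _,_; proj₁; proj₂; ∃; ∃₂)
open import Data.Sum using (_⊎_; inj₁; inj₂; [_,_]′)
open import Function using (_∘_; case_of_; _⇔_; mk⇔; Equivalence)
open import Relation.Binary.Definitions using (tri<; tri≈; tri>)
open import Relation.Binary.PropositionalEquality
open import Relation.Nullary using (¬_; contradiction; yes; no)

private variable
  A B : Set
  p q : A → Bool
  x y : A
  xs ys : List A

T-not⇔¬T : ∀ {b} → T (not b) ⇔ (¬ T b)
T-not⇔¬T {true}  = mk⇔ (λ ()) (λ ¬t → ¬t _)
T-not⇔¬T {false} = mk⇔ (λ _ ()) (λ _ → _)

¬T⇒≡false : ∀ {b} → ¬ T b → b ≡ false
¬T⇒≡false {false} _  = refl
¬T⇒≡false {true}  ¬t = contradiction _ ¬t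

¬T-∧-false : ∀ b → ¬ T (b ∧ false)
¬T-∧-false b = subst T (∧-zeroʳ b)

≢⇒T-not-≡ᵇ : ∀ {m n} → m ≢ n → T (not (m ≡ᵇ n))
≢⇒T-not-≡ᵇ m≢n = Equivalence.from T-not⇔¬T (m≢n ∘ ≡ᵇ⇒≡ _ _)

n≮ᵇn : ∀ n → ¬ T (n <ᵇ n)
n≮ᵇn n = <-irrefl refl ∘ <ᵇ⇒< n n

<⇒<ᵇ≡true : ∀ {m n} → m < n → (m <ᵇ n) ≡ true
<⇒<ᵇ≡true = Equivalence.to T-≡ ∘ <⇒<ᵇ

<ᵇ-flip : ∀ {m n} → m ≢ n → (n <ᵇ m) ≡ not (m <ᵇ n)
<ᵇ-flip {m} {n} m≢n with <-cmp m n
... | tri< m<n _ _ rewrite <⇒<ᵇ≡true m<n = ¬T⇒≡false (<-asym m<n ∘ <ᵇ⇒< n m)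
... | tri≈ _ m≡n _ = contradiction m≡n m≢n
... | tri> _ _ n<m rewrite <⇒<ᵇ≡true n<m | ¬T⇒≡false (<-asym n<m ∘ <ᵇ⇒< m n) = refl

_==_ : Bool → Bool → Bool
b == true  = b
b == false = not b

iverson : Bool → ℕ
iverson true  = 1
iverson false = 0

count : (A → Bool) → List A → ℕ
count p xs = length (filterᵇ p xs)

filterᵇ-map : (g : A → B) (xs : List A) → filterᵇ p (map g xs) ≡ map g (filterᵇ (p ∘ g) xs)
filterᵇ-map g []       = refl
filterᵇ-map {p = p} g (x ∷ xs) with p (g x)
... | true  = cong (g x ∷_) (filterᵇ-map g xs)
... | false = filterᵇ-map g xs

filterᵇ-cong-local : All (λ x → p x ≡ q x) xs → filterᵇ p xs ≡ filterᵇ q xs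
filterᵇ-cong-local [] = refl
filterᵇ-cong-local {p = p} {q} {x ∷ xs} (px≡qx ∷ eqs) with p x | q x | px≡qx
... | true  | true  | refl = cong (x ∷_) (filterᵇ-cong-local eqs)
... | false | false | refl = filterᵇ-cong-local eqs

count-cong-local : All (λ x → p x ≡ q x) xs → count p xs ≡ count q xs
count-cong-local = cong length ∘ filterᵇ-cong-local

count-none : All (λ x → ¬ T (p x)) xs → count p xs ≡ 0
count-none {p = p} = cong length ∘ filter-none (T? ∘ p)

count-singleton : ∀ (p : A → Bool) x → count p (x ∷ []) ≡ iverson (p x)
count-singleton p x with p x
... | true  = refl
... | false = refl

count≡1 : Unique xs → y ∈ xs → (∀ {x} → x ∈ xs → T (p x) → x ≡ y) → T (p y) → count p xs ≡ 1
count≡1 {p = p} (y∉ ∷ _) (here refl) only py =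
  trans (cong length (filter-accept (T? ∘ p) py))
        (cong suc (count-none (All.tabulate λ z∈ pz → All.lookup y∉ z∈ (sym (only (there z∈) pz)))))
count≡1 {p = p} (x∉ ∷ u) (there y∈) only py =
  trans (cong length (filter-reject (T? ∘ p) λ px → All.lookup x∉ y∈ (only (here refl) px)))
        (count≡1 u y∈ (only ∘ there) py)

count-++ : ∀ (p : A → Bool) xs ys → count p (xs ++ ys) ≡ count p xs + count p ys
count-++ p xs ys = trans (cong length (filter-++ (T? ∘ p) xs ys)) (length-++ (filterᵇ p xs))

count-concatMap : ∀ (p : B → Bool) (g : A → List B) xs → count p (concatMap g xs) ≡ sum (map (count p ∘ g) xs)
count-concatMap p g []       = refl
count-concatMap p g (x ∷ xs) = trans (count-++ p (g x) (concatMap g xs)) (cong (count p (g x) +_) (count-concatMap p g xs))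

count-map : ∀ (p : B → Bool) (g : A → B) xs → count p (map g xs) ≡ count (p ∘ g) xs
count-map p g xs = trans (cong length (filterᵇ-map g xs)) (length-map g (filterᵇ (p ∘ g) xs))

count-split : ∀ (p q : A → Bool) xs → count p xs ≡ count (λ x → p x ∧ q x) xs + count (λ x → p x ∧ not (q x)) xs
count-split p q [] = refl
count-split p q (x ∷ xs) with p x | q x
... | false | _     = count-split p q xs
... | true  | true  = cong suc (count-split p q xs)
... | true  | false = trans (cong suc (count-split p q xs)) (sym (+-suc _ _))

count-↭ : ∀ (p : A → Bool) → xs ↭ ys → count p xs ≡ count p ys
count-↭ p = ↭-length ∘ filter-↭ (T? ∘ p)

filterᵇ-concatMap : ∀ (g : A → List B) xs → filterᵇ p (concatMap g xs) ≡ concatMap (filterᵇ p ∘ g) xs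
filterᵇ-concatMap g []       = refl
filterᵇ-concatMap {p = p} g (x ∷ xs) =
  trans (filter-++ (T? ∘ p) (g x) (concatMap g xs)) (cong (filterᵇ p (g x) ++_) (filterᵇ-concatMap g xs))

concatMap-filterᵇ : ∀ (g : A → List B) xs → concatMap g (filterᵇ p xs) ≡ concatMap (λ x → if p x then g x else []) xs
concatMap-filterᵇ g []       = refl
concatMap-filterᵇ {p = p} g (x ∷ xs) with p x
... | true  = cong (g x ++_) (concatMap-filterᵇ g xs)
... | false = concatMap-filterᵇ g xs

filterᵇ-filterᵇ : ∀ xs → filterᵇ p (filterᵇ q xs) ≡ filterᵇ (λ x → q x ∧ p x) xs
filterᵇ-filterᵇ []                   = refl
filterᵇ-filterᵇ {p = p} {q} (x ∷ xs) with q x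
... | false = filterᵇ-filterᵇ xs
... | true  with p x
...   | true  = cong (x ∷_) (filterᵇ-filterᵇ xs)
...   | false = filterᵇ-filterᵇ xs

filterᵇ-absorb : (∀ {x} → T (p x) → T (q x)) → ∀ xs → filterᵇ p (filterᵇ q xs) ≡ filterᵇ p xs
filterᵇ-absorb {p = p} {q} p⇒q xs =
  trans (filterᵇ-filterᵇ xs) (filterᵇ-cong-local (All.universal q∧p≡p xs))
  where
  q∧p≡p : ∀ x → q x ∧ p x ≡ p x
  q∧p≡p x with p x in px
  ... | false = ∧-zeroʳ (q x)
  ... | true  = trans (∧-identityʳ (q x)) (Equivalence.to T-≡ (p⇒q (Equivalence.from T-≡ px)))

∈-tail : All (x <_) xs → (∀ {z} → z ∈ xs → z ∈ x ∷ ys) → ∀ {z} → z ∈ xs → z ∈ ys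
∈-tail x< ⊆ z∈ with ⊆ z∈
... | here refl = contradiction (All.lookup x< z∈) (<-irrefl refl)
... | there z∈′ = z∈′

sorted-ext : AllPairs _<_ xs → AllPairs _<_ ys → (∀ {z} → z ∈ xs → z ∈ ys) → (∀ {z} → z ∈ ys → z ∈ xs) → xs ≡ ys
sorted-ext {xs = []}     {[]}     _ _ _ _ = refl
sorted-ext {xs = []}     {y ∷ ys} _ _ _ ⊇ with () ← ⊇ (here refl)
sorted-ext {xs = x ∷ xs} {[]}     _ _ ⊆ _ with () ← ⊆ (here refl)
sorted-ext {xs = x ∷ xs} {y ∷ ys} (x< ∷ sx) (y< ∷ sy) ⊆ ⊇ with ⊆ (here refl) | ⊇ (here refl)
... | there x∈ys | there y∈xs = contradiction (<-trans (All.lookup x< y∈xs) (All.lookup y< x∈ys)) (<-irrefl refl)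
... | here refl  | _          = cong (x ∷_) (sorted-ext sx sy (∈-tail x< (⊆ ∘ there)) (∈-tail y< (⊇ ∘ there)))
... | there _    | here refl  = cong (x ∷_) (sorted-ext sx sy (∈-tail x< (⊆ ∘ there)) (∈-tail y< (⊇ ∘ there)))

range-sorted : ∀ n → AllPairs _<_ (range n)
range-sorted n = subst (AllPairs _<_) (sym (map-upTo suc n)) (AllPairsₚ.applyUpTo⁺₁ suc n λ i<j _ → s<s i<j)

range-unique : ∀ n → Unique (range n)
range-unique n = AllPairs.map <⇒≢ (range-sorted n)

∈-range⁻ : ∀ {n i} → i ∈ range n → ∃ λ j → j < n × i ≡ suc j
∈-range⁻ i∈ with j , j∈ , refl ← ∈-map⁻ suc i∈ = j , ∈-upTo⁻ j∈ , refl

∈-range⇒<suc : ∀ {n i} → i ∈ range n → i < suc n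
∈-range⇒<suc i∈ with j , j<n , refl ← ∈-range⁻ i∈ = s<s j<n

length-range : ∀ n → length (range n) ≡ n
length-range n = trans (length-map suc (upTo n)) (length-upTo n)

concatMap-map≡cartesianProductWith : ∀ {C : Set} (f : A → B → C) xs ys →
  concatMap (λ x → map (f x) ys) xs ≡ cartesianProductWith f xs ys
concatMap-map≡cartesianProductWith f []       ys = refl
concatMap-map≡cartesianProductWith f (x ∷ xs) ys = cong (map (f x) ys ++_) (concatMap-map≡cartesianProductWith f xs ys)

words-suc : ∀ n k → words n (suc k) ≡ cartesianProductWith _∷_ (range n) (words n k)
words-suc n k = concatMap-map≡cartesianProductWith _∷_ (range n) (words n k)

words-unique : ∀ n k → Unique (words n k)
words-unique n zero    = [] ∷ []
words-unique n (suc k) = subst Unique (sym (words-suc n k))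
  (Uniqueₚ.cartesianProductWith⁺ _∷_ ∷-injective (range-unique n) (words-unique n k))

∈-words⁺ : ∀ {n w} → All (_∈ range n) w → w ∈ words n (length w)
∈-words⁺ []               = here refl
∈-words⁺ {n} {x ∷ w} (x∈ ∷ w∈) = subst (x ∷ w ∈_) (sym (words-suc n (length w))) (∈-cartesianProductWith⁺ _∷_ x∈ (∈-words⁺ w∈))

∈-words⁻ : ∀ {n} k {w} → w ∈ words n k → length w ≡ k × All (_∈ range n) w
∈-words⁻ zero    (here refl) = refl , []
∈-words⁻ {n} (suc k) w∈
  with x , w′ , x∈ , w′∈ , refl ← ∈-cartesianProductWith⁻ _∷_ (range n) (words n k) (subst (_ ∈_) (words-suc n k) w∈)
  = cong suc (proj₁ (∈-words⁻ k w′∈)) , x∈ ∷ proj₂ (∈-words⁻ k w′∈)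

remove : ℕ → List ℕ → List ℕ
remove x = filterᵇ (λ y → not (x ≡ᵇ y))

arrangements : ℕ → List ℕ → List (List ℕ)
arrangements zero    U = [] ∷ []
arrangements (suc k) U = concatMap (λ x → map (x ∷_) (arrangements k (remove x U))) U

remove-↭ : ∀ {U x} → Unique U → x ∈ U → U ↭ x ∷ remove x U
remove-↭ {y ∷ U} (y∉ ∷ _) (here refl) = ↭-prep y (↭-reflexive (sym (begin
  remove y (y ∷ U) ≡⟨ filter-reject (T? ∘ λ z → not (y ≡ᵇ z)) (λ t → Equivalence.to T-not⇔¬T t (≡⇒≡ᵇ y y refl)) ⟩
  remove y U       ≡⟨ filter-all (T? ∘ λ z → not (y ≡ᵇ z)) (All.map ≢⇒T-not-≡ᵇ y∉) ⟩
  U                ∎)))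
  where open ≡-Reasoning
remove-↭ {y ∷ U} {x} (y∉ ∷ u) (there x∈) = begin
  y ∷ U                  ↭⟨ ↭-prep y (remove-↭ u x∈) ⟩
  y ∷ x ∷ remove x U     ↭⟨ ↭-swap y x ↭-refl ⟩
  x ∷ y ∷ remove x U     ≡⟨ cong (x ∷_) (filter-accept (T? ∘ λ z → not (x ≡ᵇ z)) (≢⇒T-not-≡ᵇ (≢-sym (All.lookup y∉ x∈)))) ⟨
  x ∷ remove x (y ∷ U)   ∎
  where open PermutationReasoning

arrangements-↭ : ∀ k {U} → Unique U → length U ≡ k → All (_↭ U) (arrangements k U)
arrangements-↭ zero    {[]} _ _ = ↭-refl ∷ []
arrangements-↭ (suc k) {U}  u |U| = Allₚ.concat⁺ (Allₚ.map⁺ (All.tabulate λ {x} x∈ →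
  let U↭ = remove-↭ u x∈ in
  Allₚ.map⁺ (All.map (λ π↭ → ↭-trans (↭-prep x π↭) (↭-sym U↭))
                    (arrangements-↭ k (Uniqueₚ.filter⁺ _ u) (suc-injective (trans (sym (↭-length U↭)) |U|))))))

all-∧-not-≡ᵇ : ∀ (q : ℕ → Bool) x w → all (λ y → q y ∧ not (x ≡ᵇ y)) w ≡ all q w ∧ not (elem x w)
all-∧-not-≡ᵇ q x []      = refl
all-∧-not-≡ᵇ q x (y ∷ w) =
  trans (cong ((q y ∧ not (x ≡ᵇ y)) ∧_) (all-∧-not-≡ᵇ q x w)) (interchange (q y) (x ≡ᵇ y) (all q w) (elem x w))
  where
  interchange : ∀ a e c l → (a ∧ not e) ∧ (c ∧ not l) ≡ (a ∧ c) ∧ not (e ∨ l)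
  interchange false _     _ _ = refl
  interchange true  true  c _ = sym (∧-zeroʳ c)
  interchange true  false _ _ = refl

-- Stated for the alphabet filterᵇ q (range n) so that the induction on k goes through:
-- fixing the first letter x replaces q by q ∧ (≠ x).
distinctWords≡arrangements : ∀ n k (q : ℕ → Bool) →
  filterᵇ (λ w → distinct w ∧ all q w) (words n k) ≡ arrangements k (filterᵇ q (range n))
distinctWords≡arrangements n zero    q = refl
distinctWords≡arrangements n (suc k) q = begin
  filterᵇ P (concatMap (λ x → map (x ∷_) (words n k)) (range n))
    ≡⟨ filterᵇ-concatMap _ (range n) ⟩
  concatMap (λ x → filterᵇ P (map (x ∷_) (words n k))) (range n)
    ≡⟨ concatMap-cong first-letter (range n) ⟩
  concatMap (λ x → if q x then map (x ∷_) (arrangements k (remove x (filterᵇ q (range n)))) else []) (range n)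
    ≡⟨ concatMap-filterᵇ _ (range n) ⟨
  arrangements (suc k) (filterᵇ q (range n)) ∎
  where
  open ≡-Reasoning
  P : List ℕ → Bool
  P w = distinct w ∧ all q w

  first-letter : ∀ x → filterᵇ P (map (x ∷_) (words n k))
                     ≡ (if q x then map (x ∷_) (arrangements k (remove x (filterᵇ q (range n)))) else [])
  first-letter x with q x in qx
  ... | false = trans (filterᵇ-map (x ∷_) (words n k))
                      (cong (map (x ∷_)) (filter-none (T? ∘ (P ∘ (x ∷_))) (All.universal not-first (words n k))))
    where
    not-first : ∀ w → ¬ T (P (x ∷ w))
    not-first w h =
      subst T qx (proj₁ (Equivalence.to T-∧ (proj₂ (Equivalence.to (T-∧ {not (elem x w) ∧ distinct w}) h))))
  ... | true  = trans (filterᵇ-map (x ∷_) (words n k)) (cong (map (x ∷_)) (begin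
    filterᵇ (P ∘ (x ∷_)) (words n k)
      ≡⟨ filterᵇ-cong-local (All.universal rearrange (words n k)) ⟩
    filterᵇ (λ w → distinct w ∧ all q′ w) (words n k)
      ≡⟨ distinctWords≡arrangements n k q′ ⟩
    arrangements k (filterᵇ q′ (range n))
      ≡⟨ cong (arrangements k) (filterᵇ-filterᵇ (range n)) ⟨
    arrangements k (remove x (filterᵇ q (range n))) ∎))
    where
    q′ : ℕ → Bool
    q′ y = q y ∧ not (x ≡ᵇ y)
    rearrange : ∀ w → P (x ∷ w) ≡ distinct w ∧ all q′ w
    rearrange w = begin
      (not (elem x w) ∧ distinct w) ∧ (q x ∧ all q w) ≡⟨ cong (λ c → (not (elem x w) ∧ distinct w) ∧ (c ∧ all q w)) qx ⟩
      (not (elem x w) ∧ distinct w) ∧ all q w ≡⟨ cong (_∧ all q w) (∧-comm (not (elem x w)) (distinct w)) ⟩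
      (distinct w ∧ not (elem x w)) ∧ all q w ≡⟨ ∧-assoc (distinct w) _ _ ⟩
      distinct w ∧ (not (elem x w) ∧ all q w) ≡⟨ cong (distinct w ∧_) (∧-comm (not (elem x w)) (all q w)) ⟩
      distinct w ∧ (all q w ∧ not (elem x w)) ≡⟨ cong (distinct w ∧_) (all-∧-not-≡ᵇ q x w) ⟨
      distinct w ∧ all q′ w                   ∎

Sn≡arrangements : ∀ n → Sn n ≡ arrangements n (range n)
Sn≡arrangements n = begin
  filterᵇ distinct (words n n)
    ≡⟨ filterᵇ-cong-local (All.universal distinct≡ (words n n)) ⟩
  filterᵇ (λ w → distinct w ∧ all (λ _ → true) w) (words n n)
    ≡⟨ distinctWords≡arrangements n n (λ _ → true) ⟩
  arrangements n (filterᵇ (λ _ → true) (range n))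
    ≡⟨ cong (arrangements n) (filter-all (T? ∘ λ _ → true) (All.universal _ (range n))) ⟩
  arrangements n (range n) ∎
  where
  open ≡-Reasoning
  all-true : ∀ (w : List ℕ) → all (λ _ → true) w ≡ true
  all-true []      = refl
  all-true (_ ∷ w) = all-true w
  distinct≡ : ∀ w → distinct w ≡ distinct w ∧ all (λ _ → true) w
  distinct≡ w = trans (sym (∧-identityʳ (distinct w))) (cong (distinct w ∧_) (sym (all-true w)))

-- The statistic and its recursion

larger : ℕ → List ℕ → List ℕ
larger x = filterᵇ (x <ᵇ_)

isPair : Bool → List ℕ → Bool
isPair f (a ∷ b ∷ []) = (a <ᵇ b) == f
isPair f _            = false

occurrences : Bool → List ℕ → ℕ
occurrences f []       = 0
occurrences f (x ∷ xs) = iverson (isPair f (larger x xs)) + occurrences f xs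

-- topAscent π: do the two largest entries of π form an ascent (false if there are fewer than
-- two)? If x has j larger entries in xs, the two largest entries of x ∷ xs are x followed by
-- the maximum of xs when j ≤ 1, and those of xs when j ≥ 2.
ascentAfter : ℕ → Bool → Bool
ascentAfter zero          _ = false
ascentAfter (suc zero)    _ = true
ascentAfter (suc (suc _)) s = s

topAscent : List ℕ → Bool
topAscent []       = false
topAscent (x ∷ xs) = ascentAfter (length (larger x xs)) (topAscent xs)

larger-larger : ∀ {x y} → x ≤ y → ∀ zs → larger y (larger x zs) ≡ larger y zs
larger-larger x≤y = filterᵇ-absorb λ {z} y<z → <⇒<ᵇ (≤-<-trans x≤y (<ᵇ⇒< _ z y<z))

topAscent-larger : ∀ x xs {a b} → larger x xs ≡ a ∷ b ∷ [] → topAscent xs ≡ (a <ᵇ b)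
topAscent-larger x (y ∷ ys) {b = b} eq with x <ᵇ y in x<y
... | false = trans (ascentAfter-≥2 two≤) (topAscent-larger x ys eq)
  where
  ascentAfter-≥2 : ∀ {j s} → 2 ≤ j → ascentAfter j s ≡ s
  ascentAfter-≥2 (s≤s (s≤s _)) = refl
  two≤ : 2 ≤ length (larger y ys)
  two≤ = begin
    2                                ≡⟨ cong length eq ⟨
    length (larger x ys)             ≡⟨ cong length (larger-larger (≮⇒≥ (λ x<y′ → subst T x<y (<⇒<ᵇ x<y′))) ys) ⟨
    length (larger x (larger y ys))  ≤⟨ length-filter (T? ∘ (x <ᵇ_)) (larger y ys) ⟩
    length (larger y ys)             ∎
    where open ≤-Reasoning
... | true with refl , rest ← ∷-injective eq = begin
  ascentAfter (length (larger y ys)) (topAscent ys)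
    ≡⟨ cong (λ zs → ascentAfter (length zs) _) (larger-larger (<⇒≤ (<ᵇ⇒< x y (subst T (sym x<y) _))) ys) ⟨
  ascentAfter (length (larger y (larger x ys))) (topAscent ys)
    ≡⟨ cong (λ zs → ascentAfter (length (larger y zs)) _) rest ⟩
  ascentAfter (length (larger y (b ∷ []))) (topAscent ys)
    ≡⟨ ascentAfter-one ⟩
  (y <ᵇ b) ∎
  where
  open ≡-Reasoning
  ascentAfter-one : ∀ {s} → ascentAfter (length (larger y (b ∷ []))) s ≡ (y <ᵇ b)
  ascentAfter-one with y <ᵇ b
  ... | true  = refl
  ... | false = refl

isPair-larger : ∀ f x xs → isPair f (larger x xs) ≡ (length (larger x xs) ≡ᵇ 2) ∧ (topAscent xs == f)
isPair-larger f x xs with larger x xs in eq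
... | []            = refl
... | _ ∷ []        = refl
... | a ∷ b ∷ []    = cong (_== f) (sym (topAscent-larger x xs eq))
... | _ ∷ _ ∷ _ ∷ _ = refl

hasProfile : Bool → ℕ → Bool → List ℕ → Bool
hasProfile f ℓ b π = (occurrences f π ≡ᵇ ℓ) ∧ (topAscent π == b)

hasProfileAfter : Bool → ℕ → ℕ → Bool → List ℕ → Bool
hasProfileAfter f j ℓ b xs =
  ((iverson ((j ≡ᵇ 2) ∧ (topAscent xs == f)) + occurrences f xs) ≡ᵇ ℓ) ∧ (ascentAfter j (topAscent xs) == b)

hasProfile-∷ : ∀ f ℓ b x xs → hasProfile f ℓ b (x ∷ xs) ≡ hasProfileAfter f (length (larger x xs)) ℓ b xs
hasProfile-∷ f ℓ b x xs = cong (λ c → ((iverson c + occurrences f xs) ≡ᵇ ℓ) ∧ _) (isPair-larger f x xs)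

-- extend f d j ℓ b counts the arrangements x ∷ xs with profile (ℓ , b) in which x has j larger
-- entries after it, given that d ℓ′ b′ counts the tails xs with profile (ℓ′ , b′).
extend : Bool → (ℕ → Bool → ℕ) → ℕ → ℕ → Bool → ℕ
extend f d zero                ℓ       b = if b then 0 else d ℓ true + d ℓ false
extend f d (suc zero)          ℓ       b = if b then d ℓ true + d ℓ false else 0
extend f d (suc (suc zero))    zero    b = if b == f then 0 else d zero b
extend f d (suc (suc zero))    (suc ℓ) b = if b == f then d ℓ b else d (suc ℓ) b
extend f d (suc (suc (suc _))) ℓ       b = d ℓ b

distribution : Bool → ℕ → ℕ → Bool → ℕ
distribution f zero    ℓ b = iverson (hasProfile f ℓ b [])
distribution f (suc k) ℓ b = sum (applyDownFrom (λ j → extend f (distribution f k) j ℓ b) (suc k))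

total : Bool → ℕ → ℕ → ℕ
total f k ℓ = distribution f k ℓ true + distribution f k ℓ false

count-by-topAscent : ∀ f ℓ (πs : List (List ℕ)) →
  count (λ π → occurrences f π ≡ᵇ ℓ) πs ≡ count (hasProfile f ℓ true) πs + count (hasProfile f ℓ false) πs
count-by-topAscent f ℓ = count-split _ topAscent

count-total : ∀ f {d : ℕ → Bool → ℕ} πs → (∀ ℓ b → count (hasProfile f ℓ b) πs ≡ d ℓ b) →
              ∀ ℓ → count (λ π → (occurrences f π ≡ᵇ ℓ) ∧ true) πs ≡ d ℓ true + d ℓ false
count-total f {d} πs d≡ ℓ = begin
  count (λ π → (occurrences f π ≡ᵇ ℓ) ∧ true) πs ≡⟨ count-cong-local (All.universal (λ _ → ∧-identityʳ _) πs) ⟩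
  count (λ π → occurrences f π ≡ᵇ ℓ) πs          ≡⟨ count-by-topAscent f ℓ πs ⟩
  count (hasProfile f ℓ true) πs + count (hasProfile f ℓ false) πs ≡⟨ cong₂ _+_ (d≡ ℓ true) (d≡ ℓ false) ⟩
  d ℓ true + d ℓ false                                             ∎
  where open ≡-Reasoning

count-hasProfileAfter : ∀ f {d : ℕ → Bool → ℕ} πs → (∀ ℓ b → count (hasProfile f ℓ b) πs ≡ d ℓ b) →
                        ∀ j ℓ b → count (hasProfileAfter f j ℓ b) πs ≡ extend f d j ℓ b
count-hasProfileAfter f {d} πs d≡ zero                ℓ true  = count-none (All.universal (λ π → ¬T-∧-false (occurrences f π ≡ᵇ ℓ)) πs)
count-hasProfileAfter f {d} πs d≡ zero                ℓ false = count-total f {d} πs d≡ ℓ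
count-hasProfileAfter f {d} πs d≡ (suc zero)          ℓ true  = count-total f {d} πs d≡ ℓ
count-hasProfileAfter f {d} πs d≡ (suc zero)          ℓ false = count-none (All.universal (λ π → ¬T-∧-false (occurrences f π ≡ᵇ ℓ)) πs)
count-hasProfileAfter f {d} πs d≡ (suc (suc zero))    ℓ b     =
  trans (count-cong-local (All.universal (λ π → same-state (λ t → (iverson t + occurrences f π) ≡ᵇ ℓ) (topAscent π) b) πs))
        (by-case ℓ)
  where
  same-state : ∀ (c : Bool → Bool) s b → c (s == f) ∧ (s == b) ≡ c (b == f) ∧ (s == b)
  same-state c true  true  = refl
  same-state c false false = refl
  same-state c true  false = trans (∧-zeroʳ _) (sym (∧-zeroʳ _))
  same-state c false true  = trans (∧-zeroʳ _) (sym (∧-zeroʳ _))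
  by-case : ∀ ℓ → count (λ π → ((iverson (b == f) + occurrences f π) ≡ᵇ ℓ) ∧ (topAscent π == b)) πs
                  ≡ extend f d 2 ℓ b
  by-case zero    with b == f
  ... | true  = count-none (All.universal (λ _ ()) πs)
  ... | false = d≡ zero b
  by-case (suc ℓ) with b == f
  ... | true  = d≡ ℓ b
  ... | false = d≡ (suc ℓ) b
count-hasProfileAfter f {d} πs d≡ (suc (suc (suc j))) ℓ b     = d≡ ℓ b

larger-head : ∀ {u U} → All (u <_) U → larger u (u ∷ U) ≡ U
larger-head {u} {U} u< = trans (filter-reject (T? ∘ (u <ᵇ_)) {u} {U} (n≮ᵇn u)) (filter-all (T? ∘ (u <ᵇ_)) (All.map <⇒<ᵇ u<))

larger-below : ∀ {u x U} → u < x → larger x (u ∷ U) ≡ larger x U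
larger-below {u} {x} {U} u<x = filter-reject (T? ∘ (x <ᵇ_)) {u} {U} (<-asym u<x ∘ <ᵇ⇒< x u)

sum-by-rank : ∀ {U} (F G : ℕ → ℕ) → AllPairs _<_ U → (∀ {x} → x ∈ U → F x ≡ G (length (larger x U))) →
              sum (map F U) ≡ sum (applyDownFrom G (length U))
sum-by-rank F G []         F≡ = refl
sum-by-rank F G (u< ∷ sU) F≡ = cong₂ _+_
  (trans (F≡ (here refl)) (cong (G ∘ length) (larger-head u<)))
  (sum-by-rank F G sU λ x∈ → trans (F≡ (there x∈)) (cong (G ∘ length) (larger-below (All.lookup u< x∈))))

count-arrangements : ∀ f k {U} → AllPairs _<_ U → length U ≡ k →
                     ∀ ℓ b → count (hasProfile f ℓ b) (arrangements k U) ≡ distribution f k ℓ b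
count-arrangements f zero    _ _ ℓ b = count-singleton (hasProfile f ℓ b) []
count-arrangements f (suc k) {U} sU |U| ℓ b = begin
  count (hasProfile f ℓ b) (concatMap (λ x → map (x ∷_) (arrangements k (remove x U))) U)
    ≡⟨ count-concatMap (hasProfile f ℓ b) _ U ⟩
  sum (map (λ x → count (hasProfile f ℓ b) (map (x ∷_) (arrangements k (remove x U)))) U)
    ≡⟨ sum-by-rank _ (λ j → extend f (distribution f k) j ℓ b) sU first-entry ⟩
  sum (applyDownFrom (λ j → extend f (distribution f k) j ℓ b) (length U))
    ≡⟨ cong (λ m → sum (applyDownFrom _ m)) |U| ⟩
  distribution f (suc k) ℓ b ∎
  where
  open ≡-Reasoning
  first-entry : ∀ {x} → x ∈ U →
    count (hasProfile f ℓ b) (map (x ∷_) (arrangements k (remove x U))) ≡ extend f (distribution f k) (length (larger x U)) ℓ b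
  first-entry {x} x∈ = begin
    count (hasProfile f ℓ b) (map (x ∷_) πs)
      ≡⟨ count-map (hasProfile f ℓ b) (x ∷_) πs ⟩
    count (hasProfile f ℓ b ∘ (x ∷_)) πs
      ≡⟨ count-cong-local (All.map cons-profile (arrangements-↭ k (Uniqueₚ.filter⁺ _ uU) |V|)) ⟩
    count (hasProfileAfter f (length (larger x U)) ℓ b) πs
      ≡⟨ count-hasProfileAfter f πs (count-arrangements f k (AllPairsₚ.filter⁺ _ sU) |V|) _ ℓ b ⟩
    extend f (distribution f k) (length (larger x U)) ℓ b ∎
    where
    uU : Unique U
    uU = AllPairs.map <⇒≢ sU
    U↭ : U ↭ x ∷ remove x U
    U↭ = remove-↭ uU x∈
    πs : List (List ℕ)
    πs = arrangements k (remove x U)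
    |V| : length (remove x U) ≡ k
    |V| = suc-injective (trans (sym (↭-length U↭)) |U|)
    rank-invariant : ∀ {π} → π ↭ remove x U → length (larger x π) ≡ length (larger x U)
    rank-invariant {π} π↭ = begin
      count (x <ᵇ_) π               ≡⟨ count-↭ (x <ᵇ_) π↭ ⟩
      count (x <ᵇ_) (remove x U)     ≡⟨ cong length (filter-reject (T? ∘ (x <ᵇ_)) {x} {remove x U} (n≮ᵇn x)) ⟨
      count (x <ᵇ_) (x ∷ remove x U) ≡⟨ count-↭ (x <ᵇ_) U↭ ⟨
      count (x <ᵇ_) U                ∎
    cons-profile : ∀ {π} → π ↭ remove x U → hasProfile f ℓ b (x ∷ π) ≡ hasProfileAfter f (length (larger x U)) ℓ b π
    cons-profile {π} π↭ = trans (hasProfile-∷ f ℓ b x π) (cong (λ j → hasProfileAfter f j ℓ b π) (rank-invariant π↭))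

-- Exchanging ascent and descent

sum-applyDownFrom-suc : ∀ (g : ℕ → ℕ) m → sum (applyDownFrom g (suc m)) ≡ sum (applyDownFrom (g ∘ suc) m) + g 0
sum-applyDownFrom-suc g zero    = +-comm (g 0) 0
sum-applyDownFrom-suc g (suc m) =
  trans (cong (g (suc m) +_) (sum-applyDownFrom-suc g m)) (sym (+-assoc (g (suc m)) _ (g 0)))

sum-applyDownFrom-cong : ∀ {g h : ℕ → ℕ} → (∀ j → g j ≡ h j) → ∀ m → sum (applyDownFrom g m) ≡ sum (applyDownFrom h m)
sum-applyDownFrom-cong g≡h zero    = refl
sum-applyDownFrom-cong g≡h (suc m) = cong₂ _+_ (g≡h m) (sum-applyDownFrom-cong g≡h m)

extend-1+0 : ∀ f d ℓ b → extend f d 1 ℓ b + extend f d 0 ℓ b ≡ d ℓ true + d ℓ false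
extend-1+0 f d ℓ true  = +-identityʳ _
extend-1+0 f d ℓ false = refl

extend-flip : ∀ {d d′} → (∀ ℓ b → d ℓ b ≡ d′ ℓ (not b)) → ∀ j ℓ b → extend true d (2 + j) ℓ b ≡ extend false d′ (2 + j) ℓ (not b)
extend-flip d≡ zero    zero    true  = refl
extend-flip d≡ zero    zero    false = d≡ zero false
extend-flip d≡ zero    (suc ℓ) true  = d≡ ℓ true
extend-flip d≡ zero    (suc ℓ) false = d≡ (suc ℓ) false
extend-flip d≡ (suc j) ℓ       b     = d≡ ℓ b

distribution-flip-step : ∀ k ℓ b → total true (suc k) ℓ ≡ total false (suc k) ℓ →
  sum (applyDownFrom (λ j → extend true (distribution true (suc k)) (2 + j) ℓ b) k)
    ≡ sum (applyDownFrom (λ j → extend false (distribution false (suc k)) (2 + j) ℓ (not b)) k) →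
  distribution true (2 + k) ℓ b ≡ distribution false (2 + k) ℓ (not b)
distribution-flip-step k ℓ b total≡ upper = begin
  sum (applyDownFrom g (2 + k))                             ≡⟨ peel g ⟩
  sum (applyDownFrom (λ j → g (2 + j)) k) + (g 1 + g 0)     ≡⟨ cong₂ _+_ upper lower ⟩
  sum (applyDownFrom (λ j → g′ (2 + j)) k) + (g′ 1 + g′ 0)  ≡⟨ peel g′ ⟨
  sum (applyDownFrom g′ (2 + k))                            ∎
  where
  open ≡-Reasoning
  g g′ : ℕ → ℕ
  g  j = extend true  (distribution true  (suc k)) j ℓ b
  g′ j = extend false (distribution false (suc k)) j ℓ (not b)
  peel : ∀ h → sum (applyDownFrom h (2 + k)) ≡ sum (applyDownFrom (λ j → h (2 + j)) k) + (h 1 + h 0)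
  peel h = begin
    sum (applyDownFrom h (2 + k))                          ≡⟨ sum-applyDownFrom-suc h (suc k) ⟩
    sum (applyDownFrom (h ∘ suc) (suc k)) + h 0            ≡⟨ cong (_+ h 0) (sum-applyDownFrom-suc (h ∘ suc) k) ⟩
    sum (applyDownFrom (λ j → h (2 + j)) k) + h 1 + h 0    ≡⟨ +-assoc _ (h 1) (h 0) ⟩
    sum (applyDownFrom (λ j → h (2 + j)) k) + (h 1 + h 0)  ∎
  lower : g 1 + g 0 ≡ g′ 1 + g′ 0
  lower = begin
    g 1 + g 0              ≡⟨ extend-1+0 true (distribution true (suc k)) ℓ b ⟩
    total true (suc k) ℓ   ≡⟨ total≡ ⟩
    total false (suc k) ℓ  ≡⟨ extend-1+0 false (distribution false (suc k)) ℓ (not b) ⟨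
    g′ 1 + g′ 0            ∎

distribution-flip : ∀ k ℓ b → distribution true (2 + k) ℓ b ≡ distribution false (2 + k) ℓ (not b)
total-flip : ∀ k ℓ → total true (2 + k) ℓ ≡ total false (2 + k) ℓ

distribution-flip zero    ℓ b = distribution-flip-step zero ℓ b refl refl
distribution-flip (suc k) ℓ b = distribution-flip-step (suc k) ℓ b (total-flip k ℓ)
  (sum-applyDownFrom-cong (λ j → extend-flip (distribution-flip k) j ℓ b) (suc k))

total-flip k ℓ = trans (cong₂ _+_ (distribution-flip k ℓ true) (distribution-flip k ℓ false))
                       (+-comm (distribution false (2 + k) ℓ false) _)

total-symmetric : ∀ k ℓ → total true k ℓ ≡ total false k ℓ
total-symmetric zero          ℓ = refl
total-symmetric (suc zero)    ℓ = refl
total-symmetric (suc (suc k)) ℓ = total-flip k ℓ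

-- Occurrences of the mesh patterns

at-∈ : ∀ (π : List ℕ) {j} → j < length π → at π (suc j) ∈ π
at-∈ (x ∷ π) {zero}  _        = here refl
at-∈ (x ∷ π) {suc j} (s≤s j<) = there (at-∈ π j<)

at-injective : ∀ {π : List ℕ} {i j} → Unique π → i < length π → j < length π → at π (suc i) ≡ at π (suc j) → i ≡ j
at-injective {x ∷ π} {zero}  {zero}  _        _        _        _  = refl
at-injective {x ∷ π} {zero}  {suc j} (x∉ ∷ _) _        (s≤s j<) eq = contradiction eq (All.lookup x∉ (at-∈ π j<))
at-injective {x ∷ π} {suc i} {zero}  (x∉ ∷ _) (s≤s i<) _        eq = contradiction (sym eq) (All.lookup x∉ (at-∈ π i<))
at-injective {x ∷ π} {suc i} {suc j} (_ ∷ u)  (s≤s i<) (s≤s j<) eq = cong suc (at-injective u i< j< eq)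

at-tail : ∀ x (π : List ℕ) (P : ℕ → Bool) →
  map (λ j → at (x ∷ π) (suc j)) (filterᵇ P (applyUpTo suc (length π)))
    ≡ map (λ j → at π (suc j)) (filterᵇ (P ∘ suc) (upTo (length π)))
at-tail x π P = begin
  map at′ (filterᵇ P (applyUpTo suc (length π)))           ≡⟨ cong (map at′ ∘ filterᵇ P) (map-upTo suc (length π)) ⟨
  map at′ (filterᵇ P (map suc (upTo (length π))))          ≡⟨ cong (map at′) (filterᵇ-map suc (upTo (length π))) ⟩
  map at′ (map suc (filterᵇ (P ∘ suc) (upTo (length π))))  ≡⟨ map-∘ _ ⟨
  map (at′ ∘ suc) (filterᵇ (P ∘ suc) (upTo (length π)))    ∎
  where
  open ≡-Reasoning
  at′ : ℕ → ℕ
  at′ j = at (x ∷ π) (suc j)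

values-above : ∀ π i y →
  map (λ j → at π (suc j)) (filterᵇ (λ j → (i <ᵇ suc j) ∧ (y <ᵇ at π (suc j))) (upTo (length π))) ≡ larger y (drop i π)
values-above []      zero    y = refl
values-above []      (suc i) y = refl
values-above (x ∷ π) zero    y with y <ᵇ x
... | true  = cong (x ∷_) (trans (at-tail x π _) (values-above π zero y))
... | false = trans (at-tail x π _) (values-above π zero y)
values-above (x ∷ π) (suc i) y = trans (at-tail x π _) (values-above π i y)

occurrences-by-position : ∀ f π →
  occurrences f π ≡ sum (map (λ j → iverson (isPair f (larger (at π (suc j)) (drop (suc j) π)))) (upTo (length π)))
occurrences-by-position f []      = refl
occurrences-by-position f (x ∷ π) = cong (iverson (isPair f (larger x π)) +_) (begin
  occurrences f π                                          ≡⟨ occurrences-by-position f π ⟩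
  sum (map (G ∘ suc) (upTo (length π)))                    ≡⟨ cong sum (map-upTo (G ∘ suc) (length π)) ⟩
  sum (applyUpTo (G ∘ suc) (length π))                     ≡⟨ cong sum (map-applyUpTo suc G (length π)) ⟨
  sum (map G (applyUpTo suc (length π)))                   ∎)
  where
  open ≡-Reasoning
  G : ℕ → ℕ
  G j = iverson (isPair f (larger (at (x ∷ π) (suc j)) (drop (suc j) (x ∷ π))))

-- R = {1,2,3}² shades the whole region north-east of the first point.
northEast : Bool → MeshPattern
northEast f = mesh 3 (1 ∷ (if f then 2 ∷ 3 ∷ [] else 3 ∷ 2 ∷ [])) R123

-- The i_a (from is = i₁ i₂ i₃) and v_a (from vs = v₁ v₂ v₃) of the definition of an
-- occurrence, with i₀ = v₀ = 0 and i₄ = v₄ = n + 1.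
boundary : ℕ → List ℕ → ℕ → ℕ
boundary n cs zero    = 0
boundary n cs (suc a) = if suc a ≡ᵇ 4 then suc n else at cs (suc a)

inBox : ℕ → List ℕ → List ℕ → List ℕ → ℕ × ℕ → ℕ → Bool
inBox n π is vs (a , b) m =
  (boundary n is a <ᵇ m) ∧ (m <ᵇ boundary n is (suc a)) ∧ (boundary n vs b <ᵇ at π m) ∧ (at π m <ᵇ boundary n vs (suc b))

emptyBoxes : ℕ → List ℕ → List ℕ → List ℕ → Bool
emptyBoxes n π is vs = all (λ ab → not (any (inBox n π is vs ab) (range n))) R123

InGap : (ℕ → ℕ) → ℕ → Set
InGap c y = ∃ λ a → a ∈ range 3 × c a < y × y < c (suc a)

inGap⇔ : ∀ {n c1 c2 c3 y} → c1 < c2 → c2 < c3 → c3 < suc n →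
         InGap (boundary n (c1 ∷ c2 ∷ c3 ∷ [])) y ⇔ (c1 < y × y < suc n × y ≢ c2 × y ≢ c3)
inGap⇔ {n} {c1} {c2} {c3} {y} c1<c2 c2<c3 c3<n = mk⇔ to from
  where
  to : InGap (boundary n (c1 ∷ c2 ∷ c3 ∷ [])) y → c1 < y × y < suc n × y ≢ c2 × y ≢ c3
  to (_ , here refl , c1<y , y<c2) =
    c1<y , <-trans y<c2 (<-trans c2<c3 c3<n) , <⇒≢ y<c2 , <⇒≢ (<-trans y<c2 c2<c3)
  to (_ , there (here refl) , c2<y , y<c3) =
    <-trans c1<c2 c2<y , <-trans y<c3 c3<n , >⇒≢ c2<y , <⇒≢ y<c3
  to (_ , there (there (here refl)) , c3<y , y<n) =
    <-trans (<-trans c1<c2 c2<c3) c3<y , y<n , >⇒≢ (<-trans c2<c3 c3<y) , >⇒≢ c3<y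
  from : c1 < y × y < suc n × y ≢ c2 × y ≢ c3 → InGap (boundary n (c1 ∷ c2 ∷ c3 ∷ [])) y
  from (c1<y , y<n , y≢c2 , y≢c3) with <-cmp y c2
  ... | tri< y<c2 _ _    = 1 , here refl , c1<y , y<c2
  ... | tri≈ _ y≡c2 _    = contradiction y≡c2 y≢c2
  ... | tri> _ _ c2<y with <-cmp y c3
  ...   | tri< y<c3 _ _  = 2 , there (here refl) , c2<y , y<c3
  ...   | tri≈ _ y≡c3 _  = contradiction y≡c3 y≢c3
  ...   | tri> _ _ c3<y  = 3 , there (there (here refl)) , c3<y , y<n

<ᵇ-box⇔ : ∀ {a b c d e f g h} →
  T ((a <ᵇ b) ∧ (c <ᵇ d) ∧ (e <ᵇ f) ∧ (g <ᵇ h)) ⇔ (a < b × c < d × e < f × g < h)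
<ᵇ-box⇔ {a} {b} {c} {d} {e} {f} {g} {h} = mk⇔ to from
  where
  to : T ((a <ᵇ b) ∧ (c <ᵇ d) ∧ (e <ᵇ f) ∧ (g <ᵇ h)) → a < b × c < d × e < f × g < h
  to t =
    let t₁ , t₂₃₄ = Equivalence.to (T-∧ {a <ᵇ b}) t
        t₂ , t₃₄  = Equivalence.to (T-∧ {c <ᵇ d}) t₂₃₄
        t₃ , t₄   = Equivalence.to (T-∧ {e <ᵇ f}) t₃₄
    in <ᵇ⇒< a b t₁ , <ᵇ⇒< c d t₂ , <ᵇ⇒< e f t₃ , <ᵇ⇒< g h t₄
  from : a < b × c < d × e < f × g < h → T ((a <ᵇ b) ∧ (c <ᵇ d) ∧ (e <ᵇ f) ∧ (g <ᵇ h))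
  from (a<b , c<d , e<f , g<h) =
    Equivalence.from T-∧ (<⇒<ᵇ a<b , Equivalence.from T-∧ (<⇒<ᵇ c<d , Equivalence.from T-∧ (<⇒<ᵇ e<f , <⇒<ᵇ g<h)))

emptyBoxes⇔ : ∀ {n π is vs} →
  T (emptyBoxes n π is vs) ⇔ (∀ {m} → m ∈ range n → InGap (boundary n is) m → InGap (boundary n vs) (at π m) → ⊥)
emptyBoxes⇔ {n} {π} {is} {vs} = mk⇔ to from
  where
  NoPoint : Set
  NoPoint = ∀ {m} → m ∈ range n → InGap (boundary n is) m → InGap (boundary n vs) (at π m) → ⊥
  isEmpty : ℕ × ℕ → Bool
  isEmpty ab = not (any (inBox n π is vs ab) (range n))
  to : T (emptyBoxes n π is vs) → NoPoint
  to empty m∈ (a , a∈ , a<m , m<a) (b , b∈ , b<πm , πm<b) =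
    Equivalence.to T-not⇔¬T (All.lookup (Allₚ.all⁺ isEmpty R123 empty) (∈-cartesianProduct⁺ a∈ b∈))
      (any⁺ (inBox n π is vs (a , b)) (lose m∈ (Equivalence.from <ᵇ-box⇔ (a<m , m<a , b<πm , πm<b))))
  from : NoPoint → T (emptyBoxes n π is vs)
  from no-point = Allₚ.all⁻ isEmpty (All.tabulate λ {(a , b)} ab∈ → Equivalence.from T-not⇔¬T λ t →
    let m , m∈ , in-box = find (any⁻ (inBox n π is vs (a , b)) (range n) t)
        a∈ , b∈ = ∈-cartesianProduct⁻ (range 3) (range 3) ab∈
        a<m , m<a , b<πm , πm<b = Equivalence.to <ᵇ-box⇔ in-box
    in no-point m∈ (a , a∈ , a<m , m<a) (b , b∈ , b<πm , πm<b))

orderIso-northEast : ∀ f {x1 x2 x3} → x1 ≢ x2 → x1 ≢ x3 → x2 ≢ x3 →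
  orderIso 3 (x1 ∷ x2 ∷ x3 ∷ []) (τ (northEast f)) ≡ (x1 <ᵇ x2) ∧ (x1 <ᵇ x3) ∧ isPair f (x2 ∷ x3 ∷ [])
orderIso-northEast f {x1} {x2} {x3} x1≢x2 x1≢x3 x2≢x3
  rewrite ¬T⇒≡false (n≮ᵇn x1) | ¬T⇒≡false (n≮ᵇn x2) | ¬T⇒≡false (n≮ᵇn x3)
        | <ᵇ-flip x1≢x2 | <ᵇ-flip x1≢x3 | <ᵇ-flip x2≢x3
  with f | x1 <ᵇ x2 | x1 <ᵇ x3 | x2 <ᵇ x3
... | true  | false | _     | _     = refl
... | true  | true  | false | _     = refl
... | true  | true  | true  | true  = refl
... | true  | true  | true  | false = refl
... | false | false | _     | _     = refl
... | false | true  | false | _     = refl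
... | false | true  | true  | true  = refl
... | false | true  | true  | false = refl

-- The last component says that {lo , hi} = {x2 , x3}.
sortℕ-northEast : ∀ {x1 x2 x3} → x1 < x2 → x1 < x3 → x2 ≢ x3 →
  ∃₂ λ lo hi → sortℕ (x1 ∷ x2 ∷ x3 ∷ []) ≡ x1 ∷ lo ∷ hi ∷ [] × lo < hi × (∀ {P : ℕ → Set} → P x2 → P x3 → P lo × P hi)
sortℕ-northEast {x1} {x2} {x3} x1<x2 x1<x3 x2≢x3 with <-cmp x2 x3
... | tri< x2<x3 _ _ = x2 , x3 , sorted , x2<x3 , _,_
  where
  sorted : sortℕ (x1 ∷ x2 ∷ x3 ∷ []) ≡ x1 ∷ x2 ∷ x3 ∷ []
  sorted rewrite <⇒<ᵇ≡true x2<x3 | <⇒<ᵇ≡true x1<x2 = refl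
... | tri≈ _ x2≡x3 _ = contradiction x2≡x3 x2≢x3
... | tri> _ _ x3<x2 = x3 , x2 , sorted , x3<x2 , λ p2 p3 → p3 , p2
  where
  sorted : sortℕ (x1 ∷ x2 ∷ x3 ∷ []) ≡ x1 ∷ x3 ∷ x2 ∷ []
  sorted rewrite ¬T⇒≡false (<-asym x3<x2 ∘ <ᵇ⇒< x2 x3) | <⇒<ᵇ≡true x1<x3 = refl

isOccurrence⇔ : ∀ τ n π is → T (isOccurrence (mesh 3 τ R123) n π is) ⇔
  (T (increasing is) × T (orderIso 3 (map (at π) is) τ) × T (emptyBoxes n π is (sortℕ (map (at π) is))))
isOccurrence⇔ τ n π is = mk⇔
  (λ t → let inc , rest = Equivalence.to (T-∧ {increasing is}) t in inc , Equivalence.to (T-∧ {orderIso 3 (map (at π) is) τ}) rest)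
  (λ (inc , order , empty) → Equivalence.from T-∧ (inc , Equivalence.from T-∧ (order , empty)))

increasing⇔ : ∀ {a b c} → T (increasing (a ∷ b ∷ c ∷ [])) ⇔ (a < b × b < c)
increasing⇔ {a} {b} {c} = mk⇔
  (λ t → let t₁ , t₂ = Equivalence.to (T-∧ {a <ᵇ b}) t in <ᵇ⇒< a b t₁ , <ᵇ⇒< b c (proj₁ (Equivalence.to (T-∧ {b <ᵇ c}) t₂)))
  (λ (a<b , b<c) → Equivalence.from T-∧ (<⇒<ᵇ a<b , Equivalence.from T-∧ (<⇒<ᵇ b<c , _)))

orderIso-northEast⇔ : ∀ f {x1 x2 x3} → x1 ≢ x2 → x1 ≢ x3 → x2 ≢ x3 →
  T (orderIso 3 (x1 ∷ x2 ∷ x3 ∷ []) (τ (northEast f))) ⇔ (x1 < x2 × x1 < x3 × T (isPair f (x2 ∷ x3 ∷ [])))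
orderIso-northEast⇔ f {x1} {x2} {x3} x1≢x2 x1≢x3 x2≢x3 = mk⇔
  (λ t → let t₁ , t₂₃ = Equivalence.to (T-∧ {x1 <ᵇ x2}) (subst T comparisons t)
             t₂ , t₃ = Equivalence.to (T-∧ {x1 <ᵇ x3}) t₂₃
         in <ᵇ⇒< x1 x2 t₁ , <ᵇ⇒< x1 x3 t₂ , t₃)
  (λ (x1<x2 , x1<x3 , shape) →
     subst T (sym comparisons) (Equivalence.from T-∧ (<⇒<ᵇ x1<x2 , Equivalence.from T-∧ (<⇒<ᵇ x1<x3 , shape))))
  where
  comparisons = orderIso-northEast f x1≢x2 x1≢x3 x2≢x3

isPair-map⁻ : ∀ f (g : ℕ → ℕ) L → T (isPair f (map g L)) → ∃₂ λ a b → L ≡ a ∷ b ∷ []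
isPair-map⁻ f g (a ∷ b ∷ []) _ = a , b , refl

module Occurrences {n : ℕ} {π : List ℕ} (π↭ : π ↭ range n) where

  |π| : length π ≡ n
  |π| = trans (↭-length π↭) (length-range n)

  value∈ : ∀ {i} → i ∈ range n → at π i ∈ range n
  value∈ i∈ with j , j<n , refl ← ∈-range⁻ i∈ = ∈-resp-↭ π↭ (at-∈ π (subst (_ <_) (sym |π|) j<n))

  values-distinct : ∀ {i i′} → i ∈ range n → i′ ∈ range n → i ≢ i′ → at π i ≢ at π i′
  values-distinct i∈ i′∈ i≢i′ eq with j , j<n , refl ← ∈-range⁻ i∈ | j′ , j′<n , refl ← ∈-range⁻ i′∈ =
    i≢i′ (cong suc (at-injective unique (subst (_ <_) (sym |π|) j<n) (subst (_ <_) (sym |π|) j′<n) eq))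
    where
    unique : Unique π
    unique = Permutationₛ.Unique-resp-↭ (setoid ℕ) (↭⇒↭ₛ (↭-sym π↭)) (range-unique n)

  isAbove : ℕ → ℕ → Bool
  isAbove i m = (i <ᵇ m) ∧ (at π i <ᵇ at π m)

  above : ℕ → List ℕ
  above i = filterᵇ (isAbove i) (range n)

  map-at-above : ∀ i → map (at π) (above i) ≡ larger (at π i) (drop i π)
  map-at-above i rewrite sym |π| = begin
    map (at π) (filterᵇ (isAbove i) (map suc (upTo (length π))))             ≡⟨ cong (map (at π)) (filterᵇ-map suc (upTo (length π))) ⟩
    map (at π) (map suc (filterᵇ (isAbove i ∘ suc) (upTo (length π))))       ≡⟨ map-∘ _ ⟨
    map (λ j → at π (suc j)) (filterᵇ (isAbove i ∘ suc) (upTo (length π)))  ≡⟨ values-above π i (at π i) ⟩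
    larger (at π i) (drop i π)                                              ∎
    where open ≡-Reasoning

  ∈-above⁻ : ∀ {i m} → m ∈ above i → m ∈ range n × i < m × at π i < at π m
  ∈-above⁻ {i} {m} m∈ =
    let m∈n , t = ∈-filter⁻ (T? ∘ isAbove i) {xs = range n} m∈
        t₁ , t₂ = Equivalence.to (T-∧ {i <ᵇ m}) t
    in m∈n , <ᵇ⇒< i m t₁ , <ᵇ⇒< (at π i) (at π m) t₂

  ∈-above⁺ : ∀ {i m} → m ∈ range n → i < m → at π i < at π m → m ∈ above i
  ∈-above⁺ {i} m∈ i<m πi<πm = ∈-filter⁺ (T? ∘ isAbove i) m∈ (Equivalence.from T-∧ (<⇒<ᵇ i<m , <⇒<ᵇ πi<πm))

  module _ {i1 i2 i3} (i1∈ : i1 ∈ range n) (i2∈ : i2 ∈ range n) (i3∈ : i3 ∈ range n) where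

    private
      x1 x2 x3 : ℕ
      x1 = at π i1
      x2 = at π i2
      x3 = at π i3

    NothingElseAbove : Set
    NothingElseAbove = ∀ {m} → m ∈ range n → i1 < m → x1 < at π m → m ≡ i2 ⊎ m ≡ i3

    above≡⇔ : above i1 ≡ i2 ∷ i3 ∷ [] ⇔ (i1 < i2 × i2 < i3 × x1 < x2 × x1 < x3 × NothingElseAbove)
    above≡⇔ = mk⇔ to from
      where
      to : above i1 ≡ i2 ∷ i3 ∷ [] → i1 < i2 × i2 < i3 × x1 < x2 × x1 < x3 × NothingElseAbove
      to above≡ with (i2<i3 ∷ []) ∷ _ ← subst (AllPairs _<_) above≡ (AllPairsₚ.filter⁺ _ (range-sorted n)) =
        let _ , i1<i2 , x1<x2 = ∈-above⁻ (subst (i2 ∈_) (sym above≡) (here refl))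
            _ , _     , x1<x3 = ∈-above⁻ (subst (i3 ∈_) (sym above≡) (there (here refl)))
        in i1<i2 , i2<i3 , x1<x2 , x1<x3 , λ m∈ i1<m x1<πm →
             case subst (_ ∈_) above≡ (∈-above⁺ m∈ i1<m x1<πm) of λ where
               (here m≡i2)         → inj₁ m≡i2
               (there (here m≡i3)) → inj₂ m≡i3
      from : i1 < i2 × i2 < i3 × x1 < x2 × x1 < x3 × NothingElseAbove → above i1 ≡ i2 ∷ i3 ∷ []
      from (i1<i2 , i2<i3 , x1<x2 , x1<x3 , only) =
        sorted-ext (AllPairsₚ.filter⁺ _ (range-sorted n)) ((i2<i3 ∷ []) ∷ [] ∷ []) ⊆ ⊇
        where
        ⊆ : ∀ {m} → m ∈ above i1 → m ∈ i2 ∷ i3 ∷ []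
        ⊆ m∈ with m∈n , i1<m , x1<πm ← ∈-above⁻ m∈ with only m∈n i1<m x1<πm
        ... | inj₁ refl = here refl
        ... | inj₂ refl = there (here refl)
        ⊇ : ∀ {m} → m ∈ i2 ∷ i3 ∷ [] → m ∈ above i1
        ⊇ (here refl)         = ∈-above⁺ i2∈ i1<i2 x1<x2
        ⊇ (there (here refl)) = ∈-above⁺ i3∈ (<-trans i1<i2 i2<i3) x1<x3

    emptyBoxes⇔NothingElseAbove : i1 < i2 → i2 < i3 → x1 < x2 → x1 < x3 →
      T (emptyBoxes n π (i1 ∷ i2 ∷ i3 ∷ []) (sortℕ (x1 ∷ x2 ∷ x3 ∷ []))) ⇔ NothingElseAbove
    emptyBoxes⇔NothingElseAbove i1<i2 i2<i3 x1<x2 x1<x3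
      with lo , hi , sorted , lo<hi , lo-hi ← sortℕ-northEast x1<x2 x1<x3 (values-distinct i2∈ i3∈ (<⇒≢ i2<i3)) =
      mk⇔ (to ∘ subst (T ∘ emptyBoxes n π (i1 ∷ i2 ∷ i3 ∷ [])) sorted)
          (subst (T ∘ emptyBoxes n π (i1 ∷ i2 ∷ i3 ∷ [])) (sym sorted) ∘ from)
      where
      in-position-gap : ∀ {y} → InGap (boundary n (i1 ∷ i2 ∷ i3 ∷ [])) y ⇔ (i1 < y × y < suc n × y ≢ i2 × y ≢ i3)
      in-position-gap = inGap⇔ i1<i2 i2<i3 (∈-range⇒<suc i3∈)
      in-value-gap : ∀ {y} → InGap (boundary n (x1 ∷ lo ∷ hi ∷ [])) y ⇔ (x1 < y × y < suc n × y ≢ lo × y ≢ hi)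
      in-value-gap = inGap⇔ (proj₁ (lo-hi {x1 <_} x1<x2 x1<x3)) lo<hi
                            (∈-range⇒<suc (proj₂ (lo-hi {_∈ range n} (value∈ i2∈) (value∈ i3∈))))
      to : T (emptyBoxes n π (i1 ∷ i2 ∷ i3 ∷ []) (x1 ∷ lo ∷ hi ∷ [])) → NothingElseAbove
      to empty {m} m∈ i1<m x1<πm with m ≟ i2 | m ≟ i3
      ... | yes m≡i2 | _        = inj₁ m≡i2
      ... | no _     | yes m≡i3 = inj₂ m≡i3
      ... | no m≢i2  | no m≢i3  = ⊥-elim (Equivalence.to (emptyBoxes⇔ {n} {π}) empty m∈
        (Equivalence.from in-position-gap (i1<m , ∈-range⇒<suc m∈ , m≢i2 , m≢i3))
        (Equivalence.from in-value-gap
          (x1<πm , ∈-range⇒<suc (value∈ m∈) ,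
           lo-hi {λ v → at π m ≢ v} (values-distinct m∈ i2∈ m≢i2) (values-distinct m∈ i3∈ m≢i3))))
      from : NothingElseAbove → T (emptyBoxes n π (i1 ∷ i2 ∷ i3 ∷ []) (x1 ∷ lo ∷ hi ∷ []))
      from only = Equivalence.from (emptyBoxes⇔ {n} {π}) λ m∈ m-gap πm-gap →
        let i1<m , _ , m≢i2 , m≢i3 = Equivalence.to in-position-gap m-gap
            x1<πm , _ = Equivalence.to in-value-gap πm-gap
        in [ m≢i2 , m≢i3 ]′ (only m∈ i1<m x1<πm)

    occurrence⇔ : ∀ f → T (isOccurrence (northEast f) n π (i1 ∷ i2 ∷ i3 ∷ []))
                        ⇔ (above i1 ≡ i2 ∷ i3 ∷ [] × T (isPair f (x2 ∷ x3 ∷ [])))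
    occurrence⇔ f = mk⇔ to from
      where
      order⇔ : i1 < i2 → i2 < i3 →
        T (orderIso 3 (x1 ∷ x2 ∷ x3 ∷ []) (τ (northEast f))) ⇔ (x1 < x2 × x1 < x3 × T (isPair f (x2 ∷ x3 ∷ [])))
      order⇔ i1<i2 i2<i3 = orderIso-northEast⇔ f
        (values-distinct i1∈ i2∈ (<⇒≢ i1<i2))
        (values-distinct i1∈ i3∈ (<⇒≢ (<-trans i1<i2 i2<i3)))
        (values-distinct i2∈ i3∈ (<⇒≢ i2<i3))
      to : T (isOccurrence (northEast f) n π (i1 ∷ i2 ∷ i3 ∷ [])) → above i1 ≡ i2 ∷ i3 ∷ [] × T (isPair f (x2 ∷ x3 ∷ []))
      to occurrence =
        let inc , order , empty     = Equivalence.to (isOccurrence⇔ (τ (northEast f)) n π (i1 ∷ i2 ∷ i3 ∷ [])) occurrence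
            i1<i2 , i2<i3           = Equivalence.to increasing⇔ inc
            x1<x2 , x1<x3 , shape   = Equivalence.to (order⇔ i1<i2 i2<i3) order
            only                    = Equivalence.to (emptyBoxes⇔NothingElseAbove i1<i2 i2<i3 x1<x2 x1<x3) empty
        in Equivalence.from above≡⇔ (i1<i2 , i2<i3 , x1<x2 , x1<x3 , only) , shape
      from : above i1 ≡ i2 ∷ i3 ∷ [] × T (isPair f (x2 ∷ x3 ∷ [])) → T (isOccurrence (northEast f) n π (i1 ∷ i2 ∷ i3 ∷ []))
      from (above≡ , shape) =
        let i1<i2 , i2<i3 , x1<x2 , x1<x3 , only = Equivalence.to above≡⇔ above≡
        in Equivalence.from (isOccurrence⇔ (τ (northEast f)) n π (i1 ∷ i2 ∷ i3 ∷ []))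
             ( Equivalence.from increasing⇔ (i1<i2 , i2<i3)
             , Equivalence.from (order⇔ i1<i2 i2<i3) (x1<x2 , x1<x3 , shape)
             , Equivalence.from (emptyBoxes⇔NothingElseAbove i1<i2 i2<i3 x1<x2 x1<x3) only)

  pair∈words : ∀ {w} → w ∈ words n 2 → ∃₂ λ a b → w ≡ a ∷ b ∷ [] × a ∈ range n × b ∈ range n
  pair∈words {a ∷ b ∷ []}    w∈ with _ , a∈ ∷ b∈ ∷ [] ← ∈-words⁻ {n} 2 w∈ = a , b , refl , a∈ , b∈
  pair∈words {[]}            w∈ with () ← proj₁ (∈-words⁻ {n} 2 w∈)
  pair∈words {_ ∷ []}        w∈ with () ← proj₁ (∈-words⁻ {n} 2 w∈)
  pair∈words {_ ∷ _ ∷ _ ∷ _} w∈ with () ← proj₁ (∈-words⁻ {n} 2 w∈)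

  occurrences-at : ∀ f {i1} → i1 ∈ range n →
    count (λ w → isOccurrence (northEast f) n π (i1 ∷ w)) (words n 2) ≡ iverson (isPair f (map (at π) (above i1)))
  occurrences-at f {i1} i1∈ with isPair f (map (at π) (above i1)) in shape
  ... | false = count-none (All.tabulate no-occurrence)
    where
    no-occurrence : ∀ {w} → w ∈ words n 2 → ¬ T (isOccurrence (northEast f) n π (i1 ∷ w))
    no-occurrence w∈ occurrence with _ , _ , refl , i2∈ , i3∈ ← pair∈words w∈ =
      let above≡ , shape′ = Equivalence.to (occurrence⇔ i1∈ i2∈ i3∈ f) occurrence
      in subst T (trans (sym (cong (isPair f ∘ map (at π)) above≡)) shape) shape′
  ... | true with a , b , above≡ ← isPair-map⁻ f (at π) (above i1) (subst T (sym shape) _) =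
    count≡1 (words-unique n 2) (∈-words⁺ (a∈ ∷ b∈ ∷ [])) only
      (Equivalence.from (occurrence⇔ i1∈ a∈ b∈ f) (above≡ , subst T (sym pair-shape) _))
    where
    pair-shape : isPair f (at π a ∷ at π b ∷ []) ≡ true
    pair-shape = trans (sym (cong (isPair f ∘ map (at π)) above≡)) shape
    a∈ = proj₁ (∈-above⁻ (subst (a ∈_) (sym above≡) (here refl)))
    b∈ = proj₁ (∈-above⁻ (subst (b ∈_) (sym above≡) (there (here refl))))
    only : ∀ {w} → w ∈ words n 2 → T (isOccurrence (northEast f) n π (i1 ∷ w)) → w ≡ a ∷ b ∷ []
    only w∈ occurrence with _ , _ , refl , i2∈ , i3∈ ← pair∈words w∈ =
      trans (sym (proj₁ (Equivalence.to (occurrence⇔ i1∈ i2∈ i3∈ f) occurrence))) above≡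

  occ-northEast : ∀ f → occ (northEast f) n π ≡ occurrences f π
  occ-northEast f = begin
    count (isOccurrence (northEast f) n π) (concatMap (λ i → map (i ∷_) (words n 2)) (range n))
      ≡⟨ count-concatMap _ (λ i → map (i ∷_) (words n 2)) (range n) ⟩
    sum (map (λ i → count (isOccurrence (northEast f) n π) (map (i ∷_) (words n 2))) (range n))
      ≡⟨ cong sum (map-cong-local (All.tabulate λ {i} i∈ → trans (count-map _ (i ∷_) (words n 2)) (occurrences-at f i∈))) ⟩
    sum (map (λ i → iverson (isPair f (map (at π) (above i)))) (map suc (upTo n)))
      ≡⟨ cong sum (map-∘ (upTo n)) ⟨
    sum (map (λ j → iverson (isPair f (map (at π) (above (suc j))))) (upTo n))
      ≡⟨ cong sum (map-cong (λ j → cong (iverson ∘ isPair f) (map-at-above (suc j))) (upTo n)) ⟩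
    sum (map G (upTo n))
      ≡⟨ cong (λ m → sum (map G (upTo m))) |π| ⟨
    sum (map G (upTo (length π)))
      ≡⟨ occurrences-by-position f π ⟨
    occurrences f π ∎
    where
    open ≡-Reasoning
    G : ℕ → ℕ
    G j = iverson (isPair f (larger (at π (suc j)) (drop (suc j) π)))

countWith-northEast : ∀ f n ℓ → countWith (northEast f) n ℓ ≡ total f n ℓ
countWith-northEast f n ℓ = begin
  count (λ π → occ (northEast f) n π ≡ᵇ ℓ) (Sn n)
    ≡⟨ cong (count (λ π → occ (northEast f) n π ≡ᵇ ℓ)) (Sn≡arrangements n) ⟩
  count (λ π → occ (northEast f) n π ≡ᵇ ℓ) (arrangements n (range n))
    ≡⟨ count-cong-local (All.map (λ π↭ → cong (_≡ᵇ ℓ) (Occurrences.occ-northEast π↭ f))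
                                 (arrangements-↭ n (range-unique n) (length-range n))) ⟩
  count (λ π → occurrences f π ≡ᵇ ℓ) (arrangements n (range n))
    ≡⟨ count-by-topAscent f ℓ (arrangements n (range n)) ⟩
  count (hasProfile f ℓ true) (arrangements n (range n)) + count (hasProfile f ℓ false) (arrangements n (range n))
    ≡⟨ cong₂ _+_ (count-arrangements f n (range-sorted n) (length-range n) ℓ true)
                 (count-arrangements f n (range-sorted n) (length-range n) ℓ false) ⟩
  total f n ℓ ∎
  where open ≡-Reasoning

theorem4p1 : p123 ∼d p132
theorem4p1 n ℓ = begin
  countWith p123 n ℓ  ≡⟨ countWith-northEast true n ℓ ⟩
  total true n ℓ      ≡⟨ total-symmetric n ℓ ⟩
  total false n ℓ     ≡⟨ countWith-northEast false n ℓ ⟨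
  countWith p132 n ℓ  ∎
  where open ≡-Reasoning
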